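{- Let $G$ be a graph, let $U\subseteq V(G)$ be a simplicial set in $G$, and let $(V_-,E_-,E_+)$ be a minimal chordal editing set of $G$. If $(V_-,E_-,E_+)$ edits $U$, then $E_-$ contains at least one edge both of whose endpoints lie in $N(U)$.
   Context: All graphs are finite, simple and undirected. A hole is an induced cycle on at least four vertices; a graph is chordal if it has no hole. For $X\subseteq V(G)$, $N(X)$ is the set of vertices outside $X$ adjacent to some vertex of $X$, and $N[X]=X\cup N(X)$. A set $X\subseteq V(G)$ is simplicial in $G$ if $G[N[X]]$ is chordal and $N(X)$ induces a clique in $G$. A chordal editing set of $G$ is a triple $(V_-,E_-,E_+)$ with $V_-\subseteq V(G)$, $E_-\subseteq E(G)$, and $E_+$ a set of non-edges of $G$, such that deleting $V_-$, deleting $E_-$ and adding $E_+$ (applied successively) makes $G$ chordal. It is minimal if there is no other chordal editing set $(V'_-,E'_-,E'_+)$ of $G$ with $V'_-\subseteq V_-$, $E'_-\subseteq E_-$, $E'_+\subseteq E_+$. The set $(V_-,E_-,E_+)$ edits $X\subseteq V(G)$ if $V_-$ contains a vertex of $X$ or $E_-\cup E_+$ contains an edge with at least one endpoint in $X$. -}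

module Defs where

open import Data.Nat using (ℕ; suc; _≤_)
open import Data.Fin using (Fin; toℕ)
open import Data.Bool using (Bool; true; false; _∧_; _∨_; not)
open import Data.Product using (Σ; _×_; ∃; ∃-syntax; _,_)
open import Data.Sum using (_⊎_)
open import Relation.Nullary using (¬_)
open import Relation.Binary.PropositionalEquality using (_≡_; _≢_)
open import Function.Definitions using (Injective)
open import Data.List.Base using (allFin)
open import Data.Bool.ListAction using (any)

record Graph (n : ℕ) : Set where
  field
    adj   : Fin n → Fin n → Bool
    sym   : ∀ u v → adj u v ≡ adj v u
    irrefl : ∀ v → adj v v ≡ false
open Graph public

VSet : ℕ → Set
VSet n = Fin n → Bool

PSet : ℕ → Set
PSet n = Fin n → Fin n → Bool

_∈ᵛ_ : ∀ {n} → Fin n → VSet n → Set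
v ∈ᵛ S = S v ≡ true

_⊆ᵛ_ : ∀ {n} → VSet n → VSet n → Set
S ⊆ᵛ T = ∀ v → v ∈ᵛ S → v ∈ᵛ T

_⊆ᵖ_ : ∀ {n} → PSet n → PSet n → Set
E ⊆ᵖ F = ∀ u v → E u v ≡ true → F u v ≡ true

CycSucc : ∀ {k} → Fin k → Fin k → Set
CycSucc {k} i j = (toℕ j ≡ suc (toℕ i)) ⊎ ((suc (toℕ i) ≡ k) × (toℕ j ≡ 0))

CycAdj : ∀ {k} → Fin k → Fin k → Set
CycAdj i j = CycSucc i j ⊎ CycSucc j i

Hole : ∀ {n} → VSet n → PSet n → Set
Hole {n} S A =
  Σ ℕ λ k → (4 ≤ k) × Σ (Fin k → Fin n) λ c →
    Injective _≡_ _≡_ c × (∀ i → c i ∈ᵛ S) ×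
    (∀ i j → (A (c i) (c j) ≡ true → CycAdj i j) × (CycAdj i j → A (c i) (c j) ≡ true))

ChordalOn : ∀ {n} → Graph n → VSet n → Set
ChordalOn G S = ¬ Hole S (adj G)

Chordal : ∀ {n} → Graph n → Set
Chordal G = ChordalOn G (λ _ → true)

N : ∀ {n} → Graph n → VSet n → Fin n → Set
N G X v = (X v ≡ false) × ∃[ x ] (x ∈ᵛ X × adj G x v ≡ true)

NC : ∀ {n} → Graph n → VSet n → Fin n → Set
NC G X v = v ∈ᵛ X ⊎ N G X v

NCb : ∀ {n} → Graph n → VSet n → VSet n
NCb {n} G X v = X v ∨ any (λ x → X x ∧ adj G x v) (allFin n)

Simplicial : ∀ {n} → Graph n → VSet n → Set
Simplicial G X =
  ChordalOn G (NCb G X) ×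
  (∀ u v → N G X u → N G X v → u ≢ v → adj G u v ≡ true)

record Editing (n : ℕ) : Set where
  constructor ⟨_,_,_⟩
  field
    V₋ : VSet n
    E₋ : PSet n
    E₊ : PSet n
open Editing public

WellFormed : ∀ {n} → Graph n → Editing n → Set
WellFormed G ed =
  (∀ u v → E₋ ed u v ≡ E₋ ed v u) × (∀ u v → E₊ ed u v ≡ E₊ ed v u) ×
  (∀ u v → E₋ ed u v ≡ true → adj G u v ≡ true) ×
  (∀ u v → E₊ ed u v ≡ true → (adj G u v ≡ false) × (u ≢ v))

resultVerts : ∀ {n} → Editing n → VSet n
resultVerts ed v = not (V₋ ed v)

resultAdj : ∀ {n} → Graph n → Editing n → PSet n
resultAdj G ed u v = (adj G u v ∧ not (E₋ ed u v)) ∨ E₊ ed u v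

IsChordalEditing : ∀ {n} → Graph n → Editing n → Set
IsChordalEditing G ed =
  WellFormed G ed × ¬ Hole (resultVerts ed) (resultAdj G ed)

IsMinimalChordalEditing : ∀ {n} → Graph n → Editing n → Set
IsMinimalChordalEditing G ed =
  IsChordalEditing G ed ×
  (∀ ed' → IsChordalEditing G ed' →
     V₋ ed' ⊆ᵛ V₋ ed → E₋ ed' ⊆ᵖ E₋ ed → E₊ ed' ⊆ᵖ E₊ ed →
     (V₋ ed ⊆ᵛ V₋ ed') × (E₋ ed ⊆ᵖ E₋ ed') × (E₊ ed ⊆ᵖ E₊ ed'))

Edits : ∀ {n} → Editing n → VSet n → Set
Edits ed X =
  (∃[ x ] (x ∈ᵛ X × x ∈ᵛ V₋ ed)) ⊎
  (∃[ x ] ∃[ y ] (x ∈ᵛ X × ((E₋ ed x y ≡ true) ⊎ (E₊ ed x y ≡ true))))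

-- Suppose E₋ has no edge inside N(U), and undo every edit touching U. A hole of the resulting
-- graph that avoids U was already a hole after the original editing. A hole that meets U stays
-- inside N[U]: there N(U) is still a clique (none of its edges was deleted) separating U from the
-- rest, and a clique cutset cannot separate two vertices of a hole. On N[U] the new graph is G
-- itself, and G[N[U]] is chordal. So the smaller editing is chordal as well, and minimality forces
-- it to contain the original one, which edits U although the smaller one does not.
module Submission where

open import Defs hiding (sym)
open import Data.Nat as ℕ using (ℕ; zero; suc; _+_; _∸_; s≤s; z≤n)
open import Data.Nat.Properties as ℕ using (+-suc; m∸n+n≡m; m≤n+m)
open import Data.Fin using (Fin; toℕ; fromℕ; fromℕ<; _≤_; _<_)
open import Data.Fin.Properties
  using (toℕ-injective; toℕ-fromℕ; toℕ-fromℕ<; toℕ<n; ≤fromℕ; ≤∧≢⇒<; <-asym; ≤-total; any?; _≟_)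
open import Data.Bool using (Bool; true; false; _∧_; _∨_; not)
open import Data.Bool.Properties as Bool
  using (¬-not; ∧-conicalˡ; ∧-zeroʳ; ∧-identityʳ; ∨-zeroʳ; ∨-identityʳ; ∨-comm; T-≡)
open import Data.Product using (∃-syntax; _×_; _,_; proj₁; proj₂)
open import Data.Sum using (_⊎_; inj₁; inj₂; [_,_]′; swap)
open import Data.Empty using (⊥; ⊥-elim)
open import Data.List.Membership.Propositional using (lose)
open import Data.List.Membership.Propositional.Properties using (∈-allFin)
open import Data.List.Relation.Unary.Any.Properties using (any⁺)
open import Function using (_∘_; Equivalence)
open import Function.Definitions using (Injective)
open import Relation.Nullary using (¬_; Dec; yes; no)
open import Relation.Nullary.Decidable using (_×-dec_)
open import Relation.Unary using (Decidable)
open import Relation.Binary.PropositionalEquality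

record Crossing {k} (f : Fin k → Bool) (a b : Fin k) : Set where
  constructor crossing
  field
    {i j}  : Fin k
    j≡1+i  : toℕ j ≡ suc (toℕ i)
    a≤i    : a ≤ i
    j≤b    : j ≤ b
    fi≢fj  : f i ≢ f j

  i≤j : i ≤ j
  i≤j = subst (toℕ i ℕ.≤_) (sym j≡1+i) (ℕ.n≤1+n _)

crossingAt : ∀ {k} (f : Fin k → Bool) d {a b : Fin k} →
             d + toℕ a ≡ toℕ b → f a ≢ f b → Crossing f a b
crossingAt f zero eq fa≢fb = ⊥-elim (fa≢fb (cong f (toℕ-injective eq)))
crossingAt f (suc d) {a} {b} eq fa≢fb = step (f a Bool.≟ f a⁺)
  where
  a<b : a < b
  a<b = subst (toℕ a ℕ.<_) eq (s≤s (m≤n+m (toℕ a) d))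
  a⁺ : Fin _
  a⁺ = fromℕ< (ℕ.≤-<-trans a<b (toℕ<n b))
  toℕ-a⁺ : toℕ a⁺ ≡ suc (toℕ a)
  toℕ-a⁺ = toℕ-fromℕ< _
  step : Dec (f a ≡ f a⁺) → Crossing f a b
  step (no fa≢fa⁺) = crossing toℕ-a⁺ ℕ.≤-refl (subst (ℕ._≤ toℕ b) (sym toℕ-a⁺) a<b) fa≢fa⁺
  step (yes fa≡fa⁺) = crossing j≡1+i (ℕ.≤-trans a≤a⁺ a≤i) j≤b fi≢fj
    where
    a≤a⁺ : a ≤ a⁺
    a≤a⁺ = subst (toℕ a ℕ.≤_) (sym toℕ-a⁺) (ℕ.n≤1+n _)
    open Crossing (crossingAt f d (trans (cong (d +_) toℕ-a⁺) (trans (+-suc d (toℕ a)) eq))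
                                  (λ fa⁺≡fb → fa≢fb (trans fa≡fa⁺ fa⁺≡fb)))

crossing-between : ∀ {k} (f : Fin k → Bool) {a b : Fin k} → a ≤ b → f a ≢ f b → Crossing f a b
crossing-between f {a} {b} a≤b = crossingAt f (toℕ b ∸ toℕ a) (m∸n+n≡m a≤b)

CycAdj-sym : ∀ {k} {i j : Fin k} → CycAdj i j → CycAdj j i
CycAdj-sym = swap

¬CycAdj-across : ∀ {K} {a b m m' : Fin (suc K)} → a < m → m < b → m' < a ⊎ b < m' → ¬ CycAdj m m'
¬CycAdj-across {K} {a} {b} {m} {m'} a<m m<b out = λ where
    (inj₁ (inj₁ m'≡1+m))      → ¬succ out m'≡1+m
    (inj₁ (inj₂ (1+m≡1+K , _))) →
      ℕ.<⇒≱ m<b (subst (toℕ b ℕ.≤_) (sym (ℕ.suc-injective 1+m≡1+K)) (ℕ.s≤s⁻¹ (toℕ<n b)))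
    (inj₂ (inj₁ m≡1+m'))      → ¬pred out m≡1+m'
    (inj₂ (inj₂ (_ , m≡0)))   → ℕ.n≮0 (subst (toℕ a ℕ.<_) m≡0 a<m)
  where
  ¬succ : toℕ m' ℕ.< toℕ a ⊎ toℕ b ℕ.< toℕ m' → toℕ m' ≢ suc (toℕ m)
  ¬succ (inj₁ m'<a) e = ℕ.<-asym a<m (ℕ.<-trans (ℕ.n<1+n _) (subst (ℕ._< toℕ a) e m'<a))
  ¬succ (inj₂ b<m') e = ℕ.<⇒≱ m<b (ℕ.s≤s⁻¹ (subst (toℕ b ℕ.<_) e b<m'))
  ¬pred : toℕ m' ℕ.< toℕ a ⊎ toℕ b ℕ.< toℕ m' → toℕ m ≢ suc (toℕ m')
  ¬pred (inj₁ m'<a) e = ℕ.<⇒≱ a<m (subst (ℕ._≤ toℕ a) (sym e) m'<a)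
  ¬pred (inj₂ b<m') e = ℕ.<-asym (ℕ.<-trans m<b b<m') (subst (toℕ m' ℕ.<_) (sym e) (ℕ.n<1+n _))

-- Both arcs of the cycle between a vertex on the side and one outside side ∪ cut must cross the
-- cut; the two cut vertices obtained are adjacent but not consecutive on the cycle.
module CliqueCutset {K : ℕ} (side : Fin (suc K) → Bool) (cut : Fin (suc K) → Set)
  (boundary : ∀ {i j} → CycAdj i j → side i ≡ true → side j ≡ false → cut j)
  (clique : ∀ {i j} → cut i → cut j → i ≢ j → CycAdj i j) where

  Separating : Fin (suc K) → Set
  Separating m = side m ≡ false × cut m

  Endpoint : Fin (suc K) → Set
  Endpoint e = side e ≡ true ⊎ ¬ cut e

  separating-≢-endpoint : ∀ {m e} → Separating m → Endpoint e → m ≢ e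
  separating-≢-endpoint (sm , _) (inj₁ se) refl with trans (sym sm) se
  ... | ()
  separating-≢-endpoint (_ , cm) (inj₂ ¬ce) refl = ¬ce cm

  separating-on-edge : ∀ {i j} → CycAdj i j → side i ≢ side j → Separating i ⊎ Separating j
  separating-on-edge {i} {j} ij si≢sj with side i in si
  ... | true  = inj₂ (sj , boundary ij si sj)
    where sj = ¬-not (si≢sj ∘ sym)
  ... | false = inj₁ (refl , boundary (CycAdj-sym ij) sj si)
    where sj = ¬-not (si≢sj ∘ sym)

  separating-between : ∀ {a b} → a ≤ b → side a ≢ side b → ∃[ m ] (a ≤ m × m ≤ b × Separating m)
  separating-between a≤b sa≢sb with crossing-between side a≤b sa≢sb
  ... | c@(crossing {i} {j} j≡1+i a≤i j≤b si≢sj) with separating-on-edge (inj₁ (inj₁ j≡1+i)) si≢sj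
  ...   | inj₁ sep = i , a≤i , ℕ.≤-trans (Crossing.i≤j c) j≤b , sep
  ...   | inj₂ sep = j , ℕ.≤-trans a≤i (Crossing.i≤j c) , j≤b , sep

  separating-around : ∀ {a b} → a ≤ b → side a ≢ side b → ∃[ m ] ((m ≤ a ⊎ b ≤ m) × Separating m)
  separating-around {a} {b} a≤b sa≢sb
    with side Fin.zero Bool.≟ side a | side b Bool.≟ side (fromℕ K)
  ... | no s0≢sa | _ with separating-between z≤n s0≢sa
  ...   | m , _ , m≤a , sep = m , inj₁ m≤a , sep
  separating-around {a} {b} a≤b sa≢sb | yes _ | no sb≢sK with separating-between (≤fromℕ b) sb≢sK
  ...   | m , b≤m , _ , sep = m , inj₂ b≤m , sep
  separating-around {a} {b} a≤b sa≢sb | yes s0≡sa | yes sb≡sK with separating-on-edge wrap sK≢s0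
    where
    wrap : CycAdj (fromℕ K) Fin.zero
    wrap = inj₁ (inj₂ (cong suc (toℕ-fromℕ K) , refl))
    sK≢s0 : side (fromℕ K) ≢ side Fin.zero
    sK≢s0 sK≡s0 = sa≢sb (trans (sym s0≡sa) (trans (sym sK≡s0) (sym sb≡sK)))
  ...   | inj₁ sep = fromℕ K , inj₂ (≤fromℕ b) , sep
  ...   | inj₂ sep = Fin.zero , inj₁ z≤n , sep

  separation-ordered : ∀ {a b} → a ≤ b → Endpoint a → Endpoint b → side a ≢ side b → ⊥
  separation-ordered {a} {b} a≤b ea eb sa≢sb
    with separating-between a≤b sa≢sb | separating-around a≤b sa≢sb
  ... | m , a≤m , m≤b , sep | m' , out , sep' =
    ¬CycAdj-across a<m m<b out' (clique (proj₂ sep) (proj₂ sep') m≢m')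
    where
    a<m : a < m
    a<m = ≤∧≢⇒< a≤m (separating-≢-endpoint sep ea ∘ sym)
    m<b : m < b
    m<b = ≤∧≢⇒< m≤b (separating-≢-endpoint sep eb)
    out' : m' < a ⊎ b < m'
    out' = [ (λ m'≤a → inj₁ (≤∧≢⇒< m'≤a (separating-≢-endpoint sep' ea)))
           , (λ b≤m' → inj₂ (≤∧≢⇒< b≤m' (separating-≢-endpoint sep' eb ∘ sym))) ]′ out
    m≢m' : m ≢ m'
    m≢m' refl = [ <-asym a<m , <-asym m<b ]′ out'

  separation : ∀ {x y} → side x ≡ true → side y ≡ false → ¬ cut y → ⊥
  separation {x} {y} sx sy ¬cy =
    [ (λ x≤y → separation-ordered x≤y (inj₁ sx) (inj₂ ¬cy) sx≢sy)
    , (λ y≤x → separation-ordered y≤x (inj₂ ¬cy) (inj₁ sx) (sx≢sy ∘ sym)) ]′ (≤-total x y)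
    where
    sx≢sy : side x ≢ side y
    sx≢sy sx≡sy with trans (sym sx) (trans sx≡sy sy)
    ... | ()

-- The data of a hole after its length, as a record so that S and A can be inferred.
record InducedCycle {n k} (S : VSet n) (A : PSet n) (c : Fin k → Fin n) : Set where
  constructor inducedCycle
  field
    injective : Injective _≡_ _≡_ c
    inside    : ∀ i → c i ∈ᵛ S
    adjacent  : ∀ i j → (A (c i) (c j) ≡ true → CycAdj i j) × (CycAdj i j → A (c i) (c j) ≡ true)

hole : ∀ {n k} {S : VSet n} {A : PSet n} {c : Fin k → Fin n} → 4 ℕ.≤ k → InducedCycle S A c → Hole S A
hole 4≤k (inducedCycle injective inside adjacent) = _ , 4≤k , _ , injective , inside , adjacent

InducedCycle-transfer : ∀ {n k} {S S' : VSet n} {A A' : PSet n} {c : Fin k → Fin n} →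
  InducedCycle S A c → (∀ i → c i ∈ᵛ S') → (∀ i j → A (c i) (c j) ≡ A' (c i) (c j)) →
  InducedCycle S' A' c
InducedCycle-transfer (inducedCycle injective _ adjacent) inside' agree =
  inducedCycle injective inside' λ i j → (proj₁ (adjacent i j) ∘ trans (agree i j)) ,
                                         (trans (sym (agree i j)) ∘ proj₂ (adjacent i j))

InducedCycle-cliqueSeparator : ∀ {n K} {S : VSet n} {A : PSet n} (X : VSet n) (Y : Fin n → Set) →
  (∀ u v → A u v ≡ true → u ∈ᵛ X → X v ≡ false → Y v) →
  (∀ u v → Y u → Y v → u ≢ v → A u v ≡ true) →
  ∀ {c : Fin (suc K) → Fin n} → InducedCycle S A c →
  ∀ {i j} → c i ∈ᵛ X → X (c j) ≡ false → ¬ Y (c j) → ⊥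
InducedCycle-cliqueSeparator X Y boundary clique {c} (inducedCycle injective _ adjacent) = separation
  where
  open CliqueCutset (X ∘ c) (Y ∘ c)
    (λ {i} {j} ij → boundary (c i) (c j) (proj₂ (adjacent i j) ij))
    (λ {i} {j} Yi Yj i≢j → proj₁ (adjacent i j) (clique (c i) (c j) Yi Yj (i≢j ∘ injective)))

N? : ∀ {n} (G : Graph n) (X : VSet n) → Decidable (N G X)
N? G X v = (X v Bool.≟ false) ×-dec any? (λ x → (X x Bool.≟ true) ×-dec (adj G x v Bool.≟ true))

NC⇒NCb : ∀ {n} {G : Graph n} {X : VSet n} {v} → NC G X v → NCb G X v ≡ true
NC⇒NCb (inj₁ v∈X) rewrite v∈X = refl
NC⇒NCb (inj₂ (v∉X , x , x∈X , xv)) rewrite v∉X =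
  Equivalence.to T-≡ (any⁺ _ (lose (∈-allFin x) (Equivalence.from T-≡ (cong₂ _∧_ x∈X xv))))

avoids : ∀ {n} → VSet n → Fin n → Fin n → Bool
avoids X u v = not (X u ∨ X v)

editingOutside : ∀ {n} → VSet n → Editing n → Editing n
editingOutside X ed =
  ⟨ (λ v → V₋ ed v ∧ not (X v)) , (λ u v → E₋ ed u v ∧ avoids X u v) , (λ u v → E₊ ed u v ∧ avoids X u v) ⟩

_⊑_ : ∀ {n} → Editing n → Editing n → Set
ed ⊑ ed' = (V₋ ed ⊆ᵛ V₋ ed') × (E₋ ed ⊆ᵖ E₋ ed') × (E₊ ed ⊆ᵖ E₊ ed')

editingOutside-⊑ : ∀ {n} (X : VSet n) (ed : Editing n) → editingOutside X ed ⊑ ed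
editingOutside-⊑ X ed = (λ v → ∧-conicalˡ _ _) , (λ u v → ∧-conicalˡ _ _) , (λ u v → ∧-conicalˡ _ _)

minimal-⊑ : ∀ {n} {G : Graph n} {ed ed' : Editing n} →
  IsMinimalChordalEditing G ed → IsChordalEditing G ed' → ed' ⊑ ed → ed ⊑ ed'
minimal-⊑ (_ , minimal) chordal' (V⊆ , E₋⊆ , E₊⊆) = minimal _ chordal' V⊆ E₋⊆ E₊⊆

Edits-mono : ∀ {n} {ed ed' : Editing n} {X : VSet n} → ed ⊑ ed' → Edits ed X → Edits ed' X
Edits-mono (V⊆ , _ , _) (inj₁ (x , x∈X , x∈V₋)) = inj₁ (x , x∈X , V⊆ x x∈V₋)
Edits-mono (_ , E₋⊆ , _) (inj₂ (x , y , x∈X , inj₁ xy∈E₋)) = inj₂ (x , y , x∈X , inj₁ (E₋⊆ x y xy∈E₋))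
Edits-mono (_ , _ , E₊⊆) (inj₂ (x , y , x∈X , inj₂ xy∈E₊)) = inj₂ (x , y , x∈X , inj₂ (E₊⊆ x y xy∈E₊))

editingOutside-¬Edits : ∀ {n} (X : VSet n) (ed : Editing n) → ¬ Edits (editingOutside X ed) X
editingOutside-¬Edits X ed (inj₁ (x , x∈X , x∈V₋)) rewrite x∈X | ∧-zeroʳ (V₋ ed x) with x∈V₋
... | ()
editingOutside-¬Edits X ed (inj₂ (x , y , x∈X , xy∈E)) rewrite x∈X
  | ∧-zeroʳ (E₋ ed x y) | ∧-zeroʳ (E₊ ed x y) with xy∈E
... | inj₁ ()
... | inj₂ ()

resultAdj-irrefl : ∀ {n} {G : Graph n} {ed : Editing n} → WellFormed G ed → ∀ v → resultAdj G ed v v ≡ false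
resultAdj-irrefl {G = G} (_ , _ , _ , E₊⊆∁E) v rewrite irrefl G v =
  ¬-not (λ vv∈E₊ → proj₂ (E₊⊆∁E v v vv∈E₊) refl)

module EditingOutside {n} (G : Graph n) (X : VSet n) (ed : Editing n) where

  editingOutside-wellFormed : WellFormed G ed → WellFormed G (editingOutside X ed)
  editingOutside-wellFormed (E₋-sym , E₊-sym , E₋⊆E , E₊⊆∁E) =
    sym-masked E₋-sym , sym-masked E₊-sym ,
    (λ u v → E₋⊆E u v ∘ ∧-conicalˡ _ _) , (λ u v → E₊⊆∁E u v ∘ ∧-conicalˡ _ _)
    where
    sym-masked : ∀ {E : PSet n} → (∀ u v → E u v ≡ E v u) →
                 ∀ u v → E u v ∧ avoids X u v ≡ E v u ∧ avoids X v u
    sym-masked E-sym u v = cong₂ (λ e w → e ∧ not w) (E-sym u v) (∨-comm (X u) (X v))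

  resultAdj-editingOutside-touching : ∀ {u v} →
    X u ∨ X v ≡ true → resultAdj G (editingOutside X ed) u v ≡ adj G u v
  resultAdj-editingOutside-touching {u} {v} touches
    rewrite touches | ∧-zeroʳ (E₋ ed u v) | ∧-zeroʳ (E₊ ed u v)
    = trans (∨-identityʳ _) (∧-identityʳ (adj G u v))

  resultAdj-editingOutside-avoiding : ∀ {u v} →
    X u ∨ X v ≡ false → resultAdj G (editingOutside X ed) u v ≡ resultAdj G ed u v
  resultAdj-editingOutside-avoiding {u} {v} avoiding
    rewrite avoiding | ∧-identityʳ (E₋ ed u v) | ∧-identityʳ (E₊ ed u v) = refl

  resultVerts-editingOutside : ∀ {v} → X v ≡ false → resultVerts (editingOutside X ed) v ≡ resultVerts ed v
  resultVerts-editingOutside {v} v∉X rewrite v∉X = cong not (∧-identityʳ (V₋ ed v))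

module _ {n} (G : Graph n) (U : VSet n) (ed : Editing n) (simplicial : Simplicial G U)
  (wellFormed : WellFormed G ed) (chordal : ¬ Hole (resultVerts ed) (resultAdj G ed))
  (noDeletionInN : ∀ u v → N G U u → N G U v → E₋ ed u v ≡ false) where

  open EditingOutside G U ed

  private
    ed' : Editing n
    ed' = editingOutside U ed

    A' : PSet n
    A' = resultAdj G ed'

  editingOutside-boundary : ∀ u v → A' u v ≡ true → u ∈ᵛ U → U v ≡ false → N G U v
  editingOutside-boundary u v uv u∈U v∉U =
    v∉U , u , u∈U , trans (sym (resultAdj-editingOutside-touching (cong (_∨ U v) u∈U))) uv

  editingOutside-clique : ∀ u v → N G U u → N G U v → u ≢ v → A' u v ≡ true
  editingOutside-clique u v Nu Nv u≢v
    rewrite proj₂ simplicial u v Nu Nv u≢v | noDeletionInN u v Nu Nv = refl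

  resultAdj-editingOutside-on-N[U] : ∀ {u v} → NC G U u → NC G U v → A' u v ≡ adj G u v
  resultAdj-editingOutside-on-N[U] {v = v} (inj₁ u∈U) _ =
    resultAdj-editingOutside-touching (cong (_∨ U v) u∈U)
  resultAdj-editingOutside-on-N[U] {u} (inj₂ _) (inj₁ v∈U) =
    resultAdj-editingOutside-touching (trans (cong (U u ∨_) v∈U) (∨-zeroʳ (U u)))
  resultAdj-editingOutside-on-N[U] {u} {v} (inj₂ Nu) (inj₂ Nv) with u ≟ v
  ... | no u≢v = trans (editingOutside-clique u v Nu Nv u≢v) (sym (proj₂ simplicial u v Nu Nv u≢v))
  ... | yes refl =
    trans (resultAdj-irrefl {G = G} {ed'} (editingOutside-wellFormed wellFormed) u) (sym (irrefl G u))

  editingOutside-noInducedCycle : ∀ {K} {c : Fin (suc K) → Fin n} → 4 ℕ.≤ suc K →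
    InducedCycle (resultVerts ed') A' c → ⊥
  editingOutside-noInducedCycle {K} {c} 4≤k cycle@(inducedCycle _ inS _)
    with any? (λ i → U (c i) Bool.≟ true)
  ... | no noneInU =
    chordal (hole 4≤k (InducedCycle-transfer {S' = resultVerts ed} {A' = resultAdj G ed} cycle inS-ed agree))
    where
    ∉U : ∀ i → U (c i) ≡ false
    ∉U i = ¬-not (noneInU ∘ (i ,_))
    inS-ed : ∀ i → c i ∈ᵛ resultVerts ed
    inS-ed i = trans (sym (resultVerts-editingOutside (∉U i))) (inS i)
    agree : ∀ i j → A' (c i) (c j) ≡ resultAdj G ed (c i) (c j)
    agree i j = resultAdj-editingOutside-avoiding (cong₂ _∨_ (∉U i) (∉U j))
  ... | yes (i , ci∈U) =
    proj₁ simplicial (hole 4≤k (InducedCycle-transfer {S' = NCb G U} {A' = adj G} cycle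
      (NC⇒NCb {G = G} ∘ inN[U]) (λ j j' → resultAdj-editingOutside-on-N[U] (inN[U] j) (inN[U] j'))))
    where
    inN[U] : ∀ j → NC G U (c j)
    inN[U] j with U (c j) Bool.≟ true | N? G U (c j)
    ... | yes cj∈U | _       = inj₁ cj∈U
    ... | no  _    | yes Nj  = inj₂ Nj
    ... | no  cj∉U | no  ¬Nj = ⊥-elim (InducedCycle-cliqueSeparator U (N G U)
      editingOutside-boundary editingOutside-clique cycle ci∈U (¬-not cj∉U) ¬Nj)

  editingOutside-chordal : ¬ Hole (resultVerts ed') A'
  editingOutside-chordal (zero , () , _)
  editingOutside-chordal (suc K , 4≤k , c , injective , inside , adjacent) =
    editingOutside-noInducedCycle 4≤k (inducedCycle injective inside adjacent)

lemma7 : ∀ {n} (G : Graph n) (U : VSet n) (ed : Editing n) →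
    Simplicial G U → IsMinimalChordalEditing G ed → Edits ed U →
    ∃[ u ] ∃[ v ] (N G U u × N G U v × E₋ ed u v ≡ true)
lemma7 G U ed simplicial minimal@((wellFormed , chordal) , _) edits
  with any? (λ u → any? (λ v → N? G U u ×-dec N? G U v ×-dec (E₋ ed u v Bool.≟ true)))
... | yes deletion = deletion
... | no noDeletion = ⊥-elim (editingOutside-¬Edits U ed (Edits-mono ed⊑ed' edits))
  where
  noDeletionInN : ∀ u v → N G U u → N G U v → E₋ ed u v ≡ false
  noDeletionInN u v Nu Nv = ¬-not λ uv∈E₋ → noDeletion (u , v , Nu , Nv , uv∈E₋)
  ed⊑ed' : ed ⊑ editingOutside U ed
  ed⊑ed' = minimal-⊑ {G = G} minimal
    (EditingOutside.editingOutside-wellFormed G U ed wellFormed ,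
     editingOutside-chordal G U ed simplicial wellFormed chordal noDeletionInN)
    (editingOutside-⊑ U ed)
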